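{- Let $\underline a\in\mathbb{F}_2^{(\mathbb{Z}_{\ge0})}$. The following are equivalent: \begin{enumerate} \item either $a_0=0$, or there is no positive integer $i$ with $a_i=1$; \item the continuous epimorphism $\phi_{\mathbb{Z}_{\ge0}}:M_{\underline a}\twoheadrightarrow\{\underline x\in\mathbb{F}_2^{\mathbb{Z}_{\ge0}}:\sum_ia_ix_i=0\}$, $\sigma\mapsto(\phi_i(\sigma))_{i\ge0}$, admits a set-theoretic section $f$ for which there is a set $T$ of topological generators of $\{\underline x\in\mathbb{F}_2^{\mathbb{Z}_{\ge0}}:\sum_ia_ix_i=0\}$ such that $f(t)$ is an involution for every $t\in T$. \end{enumerate}
   Context: $\Omega_\infty$: profinite automorphism group of the rooted binary tree $T_\infty$ (Cayley graph of the free monoid on $\{x,y\}$, word $w$ joined to $xw,yw$; $L_i$ = words of length $i$). For a word $w$, $\sigma_w$ is the involution fixing words not ending in $w$ and sending $v'w\mapsto\overline{v'}w$ ($x,y$ swapped in $v'$); each $\sigma$ is uniquely $\lim_N\sigma_N\cdots\sigma_0$ with $\sigma_i=\prod_{w\in L_i}\sigma_w^{\varepsilon_w(\sigma)}$, and $\phi_i(\sigma)=\sum_{w\in L_i}\varepsilon_w(\sigma)\in\mathbb{F}_2$. $\mathbb{F}_2^{(\mathbb{Z}_{\ge0})}$ are finitely supported sequences, $\mathbb{F}_2^{\mathbb{Z}_{\ge0}}$ all sequences (product topology); $M_{\underline a}=\ker\sum_ia_i\phi_i$. -}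

module Defs where

open import Data.Bool using (Bool; true; false; not; _∧_; _xor_; if_then_else_)
open import Data.Nat using (ℕ; zero; suc; _∸_; _<_)
open import Data.List using (List; []; _∷_; length; map; drop; foldr; _++_)
open import Data.List.Relation.Unary.All using (All)
open import Data.Product using (Σ; _×_)
open import Data.Sum using (_⊎_)
open import Relation.Binary.PropositionalEquality using (_≡_)
open import Relation.Nullary using (¬_)

-- Letters: x = false, y = true.  A word is a list of letters; the tree edge
-- joins w to x ∷ w and y ∷ w (new letters are prepended at the head).
Word : Set
Word = List Bool

words : ℕ → List Word
words zero = [] ∷ []
words (suc i) = map (false ∷_) (words i) ++ map (true ∷_) (words i)

-- An element σ of Ω∞ is given by its (unique) coordinates ε_w(σ) ∈ F₂,
-- σ = lim σ_N ⋯ σ_0, σ_i = ∏_{w ∈ L_i} σ_w^{ε_w(σ)}.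
Ω∞ : Set
Ω∞ = Word → Bool

flipTake : ℕ → Word → Word
flipTake zero u = u
flipTake (suc k) [] = []
flipTake (suc k) (b ∷ u) = not b ∷ flipTake k u

-- action of σ_i = ∏_{w∈L_i} σ_w^{ε_w} on a word u: if u = v'w with |w| = i
-- and ε_w = 1, swap x,y in v'; otherwise (incl. |u| ≤ i) fix u.
step : ℕ → Ω∞ → Word → Word
step i σ u = if σ (drop (length u ∸ i) u) then flipTake (length u ∸ i) u else u

actUpTo : ℕ → Ω∞ → Word → Word
actUpTo zero σ u = u
actUpTo (suc k) σ u = step k σ (actUpTo k σ u)

-- action of σ on the tree (σ_i with i ≥ |u| fix u)
act : Ω∞ → Word → Word
act σ u = actUpTo (length u) σ u

idΩ : Ω∞
idΩ _ = false

-- σ is an involution: σ² = 1 and σ ≠ 1 (in the faithful action on T∞)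
IsInvolution : Ω∞ → Set
IsInvolution σ = (∀ u → act σ (act σ u) ≡ u) × ¬ (∀ u → act σ u ≡ u)

φ : ℕ → Ω∞ → Bool
φ i σ = foldr _xor_ false (map σ (words i))

-- finitely supported sequences a ∈ F₂^(ℤ≥0), given by a finite list of
-- initial coefficients (a_i = 0 beyond the list)
coef : List Bool → ℕ → Bool
coef [] i = false
coef (b ∷ a) zero = b
coef (b ∷ a) (suc i) = coef a i

dot : List Bool → (ℕ → Bool) → Bool
dot [] x = false
dot (b ∷ a) x = (b ∧ x 0) xor dot a (λ i → x (suc i))

InM : List Bool → Ω∞ → Set
InM a σ = dot a (λ i → φ i σ) ≡ false

InX : List Bool → (ℕ → Bool) → Set
InX a x = dot a x ≡ false

sumSeq : List (ℕ → Bool) → ℕ → Bool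
sumSeq [] i = false
sumSeq (t ∷ ts) i = t i xor sumSeq ts i

-- T is a set of topological generators of X_a: T ⊆ X_a and the closure
-- (product topology) of the subgroup generated by T is X_a, i.e. every
-- x ∈ X_a agrees on each initial segment [0,n) with a finite sum of
-- elements of T.
TopGenerates : List Bool → ((ℕ → Bool) → Set) → Set
TopGenerates a T =
  (∀ t → T t → InX a t) ×
  (∀ x → InX a x → ∀ n → Σ (List (ℕ → Bool)) λ ts →
      All T ts × (∀ i → i < n → sumSeq ts i ≡ x i))

Cond1 : List Bool → Set
Cond1 a = (coef a 0 ≡ false) ⊎ (¬ (Σ ℕ λ i → (0 < i) × (coef a i ≡ true)))

Cond2 : List Bool → Set₁
Cond2 a =
  Σ ((x : ℕ → Bool) → InX a x → Σ Ω∞ (InM a)) λ f →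
    (∀ x (p : InX a x) i → φ i (Σ.proj₁ (f x p)) ≡ x i) ×
    Σ ((ℕ → Bool) → Set) λ T →
      TopGenerates a T × (∀ t (p : InX a t) → T t → IsInvolution (Σ.proj₁ (f t p)))

{-# OPTIONS --safe #-}
module Submission where

-- An automorphism σ acts by  σ(b ∷ u) = (b xor flipBit σ u) ∷ σ u,  where flipBit σ u is the
-- sum of the coordinates ε of σ along the suffixes of σ u.  If σ is an involution, flipBit σ
-- is σ-invariant and ε_{bw} = flipBit(bw) + flipBit(w), so φ_{i+1}(σ) is the sum of flipBit σ
-- over L_{i+1}.  If moreover ε_∅ = 1, every σ-invariant function has zero sum over each level
-- L_{i+1}: summing out the head letter preserves invariance, and on L_1 σ swaps x and y.
-- Hence φ(σ) = e₀ for an involution σ with φ₀(σ) = 1.  If a₀ = 1 and a_i = 1 for some i > 0,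
-- then e₀ + e_i ∈ X_a, so some generator t has t₀ = 1; its lift f(t) is such an involution,
-- forcing t = e₀ ∉ X_a.
-- Conversely the section x ↦ σ_∅^{x₀} ∏_k σ_{yx^k}^{x_{k+1}} sends e₀ and every non-zero x
-- with x₀ = 0 to an involution, and under (1) these elements of X_a generate X_a.

open import Defs
open import Algebra.Bundles using (CommutativeRing)
open import Data.Bool using (Bool; true; false; not; _∧_; _xor_; if_then_else_)
  renaming (_≟_ to _≟ᵇ_)
open import Data.Bool.Properties
  using (xor-assoc; xor-comm; xor-same; xor-identityʳ; true-xor; not-involutive; ∧-zeroʳ; ∧-identityʳ; ¬-not;
         xor-∧-commutativeRing)
open import Algebra.Properties.CommutativeSemigroup (CommutativeRing.+-commutativeSemigroup xor-∧-commutativeRing) using () renaming (interchange to xor-interchange)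
open import Data.Nat using (ℕ; zero; suc; _∸_; _<_; _≤_; _≡ᵇ_; z≤n; s≤s)
open import Data.Nat.Properties using (+-∸-assoc; n∸n≡0; ≤-refl; m≤n⇒m≤1+n; anyUpTo?)
open import Data.List using (List; []; _∷_; length; map; drop; foldr; _++_; replicate; head)
open import Data.List.Properties using (map-++; map-∘; length-replicate)
open import Data.List.Relation.Unary.All using (All; []; _∷_)
open import Data.List.Relation.Unary.All.Properties using (++⁺)
open import Data.Maybe using (Maybe; just; nothing; is-nothing)
open import Data.Maybe.Properties using (just-injective)
open import Data.Product using (Σ; ∃; _×_; _,_; proj₁; proj₂)
open import Data.Sum using (_⊎_; inj₁; inj₂)
open import Relation.Nullary using (¬_; yes; no)
open import Relation.Binary.PropositionalEquality
open ≡-Reasoning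
open import Function.Bundles using (_⇔_; mk⇔)

xor-cancelˡ : ∀ a b → a xor (a xor b) ≡ b
xor-cancelˡ false b = refl
xor-cancelˡ true b = trans (true-xor (not b)) (not-involutive b)

xor≡false⇒≡ : ∀ a b → a xor b ≡ false → a ≡ b
xor≡false⇒≡ false false _ = refl
xor≡false⇒≡ true true _ = refl

≡xor⇒xor≡ : ∀ a b c → a ≡ b xor c → a xor b ≡ c
≡xor⇒xor≡ a b c refl = trans (cong (_xor b) (xor-comm b c))
  (trans (xor-assoc c b b) (trans (cong (c xor_) (xor-same b)) (xor-identityʳ c)))

length-flipTake : ∀ k u → length (flipTake k u) ≡ length u
length-flipTake zero u = refl
length-flipTake (suc k) [] = refl
length-flipTake (suc k) (b ∷ u) = cong suc (length-flipTake k u)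

length-step : ∀ i σ u → length (step i σ u) ≡ length u
length-step i σ u with σ (drop (length u ∸ i) u)
... | true = length-flipTake (length u ∸ i) u
... | false = refl

length-actUpTo : ∀ k σ u → length (actUpTo k σ u) ≡ length u
length-actUpTo zero σ u = refl
length-actUpTo (suc k) σ u = trans (length-step k σ (actUpTo k σ u)) (length-actUpTo k σ u)

length-act : ∀ σ u → length (act σ u) ≡ length u
length-act σ u = length-actUpTo (length u) σ u

flipBitUpTo : ℕ → Ω∞ → Word → Bool
flipBitUpTo zero σ u = false
flipBitUpTo (suc k) σ u = flipBitUpTo k σ u xor σ (drop (length u ∸ k) (actUpTo k σ u))

flipBit : Ω∞ → Word → Bool
flipBit σ u = flipBitUpTo (suc (length u)) σ u

step-∷ : ∀ k σ c w → k ≤ length w →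
  step k σ (c ∷ w) ≡ (c xor σ (drop (length w ∸ k) w)) ∷ step k σ w
step-∷ k σ c w k≤|w| rewrite +-∸-assoc 1 k≤|w| with σ (drop (length w ∸ k) w)
... | true = cong (_∷ _) (sym (trans (xor-comm c true) (true-xor c)))
... | false = cong (_∷ _) (sym (xor-identityʳ c))

step-fixes-length : ∀ k σ w → length w ≡ k → step k σ w ≡ w
step-fixes-length k σ w refl rewrite n∸n≡0 (length w) with σ w
... | true = refl
... | false = refl

actUpTo-∷ : ∀ σ b u k → k ≤ suc (length u) →
  actUpTo k σ (b ∷ u) ≡ (b xor flipBitUpTo k σ u) ∷ actUpTo k σ u
actUpTo-∷ σ b u zero _ = cong (_∷ u) (sym (xor-identityʳ b))
actUpTo-∷ σ b u (suc k) (s≤s k≤|u|) = begin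
    step k σ (actUpTo k σ (b ∷ u))
  ≡⟨ cong (step k σ) (actUpTo-∷ σ b u k (m≤n⇒m≤1+n k≤|u|)) ⟩
    step k σ (c ∷ w)
  ≡⟨ step-∷ k σ c w (subst (k ≤_) (sym |w|≡|u|) k≤|u|) ⟩
    (c xor σ (drop (length w ∸ k) w)) ∷ step k σ w
  ≡⟨ cong (λ n → (c xor σ (drop (n ∸ k) w)) ∷ step k σ w) |w|≡|u| ⟩
    (c xor σ (drop (length u ∸ k) w)) ∷ step k σ w
  ≡⟨ cong (_∷ step k σ w) (xor-assoc b _ _) ⟩
    (b xor flipBitUpTo (suc k) σ u) ∷ step k σ w
  ∎
  where
  c : Bool
  c = b xor flipBitUpTo k σ u
  w : Word
  w = actUpTo k σ u
  |w|≡|u| : length w ≡ length u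
  |w|≡|u| = length-actUpTo k σ u

act-∷ : ∀ σ b u → act σ (b ∷ u) ≡ (b xor flipBit σ u) ∷ act σ u
act-∷ σ b u = trans (actUpTo-∷ σ b u (suc (length u)) ≤-refl)
  (cong ((b xor flipBit σ u) ∷_) (step-fixes-length (length u) σ (act σ u) (length-act σ u)))

flipBitUpTo-∷ : ∀ σ b u k → k ≤ suc (length u) → flipBitUpTo k σ (b ∷ u) ≡ flipBitUpTo k σ u
flipBitUpTo-∷ σ b u zero _ = refl
flipBitUpTo-∷ σ b u (suc k) (s≤s k≤|u|)
  rewrite actUpTo-∷ σ b u k (m≤n⇒m≤1+n k≤|u|) | +-∸-assoc 1 k≤|u| =
  cong (_xor σ (drop (length u ∸ k) (actUpTo k σ u))) (flipBitUpTo-∷ σ b u k (m≤n⇒m≤1+n k≤|u|))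

flipBit-∷ : ∀ σ b u → flipBit σ (b ∷ u) ≡ flipBit σ u xor σ (act σ (b ∷ u))
flipBit-∷ σ b u = cong₂ _xor_ (flipBitUpTo-∷ σ b u (suc (length u)) ≤-refl)
  (cong (λ n → σ (drop n (act σ (b ∷ u)))) (n∸n≡0 (length u)))

levelSum : ℕ → (Word → Bool) → Bool
levelSum zero g = g []
levelSum (suc j) g = levelSum j (λ w → g (false ∷ w)) xor levelSum j (λ w → g (true ∷ w))

xorSum : List Bool → Bool
xorSum = foldr _xor_ false

xorSum-++ : ∀ xs ys → xorSum (xs ++ ys) ≡ xorSum xs xor xorSum ys
xorSum-++ [] ys = refl
xorSum-++ (x ∷ xs) ys = trans (cong (x xor_) (xorSum-++ xs ys)) (sym (xor-assoc x _ _))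

φ≡levelSum : ∀ j σ → φ j σ ≡ levelSum j σ
φ≡levelSum zero σ = xor-identityʳ (σ [])
φ≡levelSum (suc j) σ = begin
    xorSum (map σ (map (false ∷_) (words j) ++ map (true ∷_) (words j)))
  ≡⟨ cong xorSum (map-++ σ (map (false ∷_) (words j)) _) ⟩
    xorSum (map σ (map (false ∷_) (words j)) ++ map σ (map (true ∷_) (words j)))
  ≡⟨ xorSum-++ (map σ (map (false ∷_) (words j))) _ ⟩
    xorSum (map σ (map (false ∷_) (words j))) xor xorSum (map σ (map (true ∷_) (words j)))
  ≡⟨ cong₂ _xor_ (trans (cong xorSum (sym (map-∘ (words j)))) (φ≡levelSum j (λ w → σ (false ∷ w))))
                 (trans (cong xorSum (sym (map-∘ (words j)))) (φ≡levelSum j (λ w → σ (true ∷ w)))) ⟩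
    levelSum (suc j) σ
  ∎

levelSum-cong : ∀ j {f g : Word → Bool} → (∀ w → f w ≡ g w) → levelSum j f ≡ levelSum j g
levelSum-cong zero f≗g = f≗g []
levelSum-cong (suc j) f≗g =
  cong₂ _xor_ (levelSum-cong j (λ w → f≗g (false ∷ w))) (levelSum-cong j (λ w → f≗g (true ∷ w)))

levelSum-xor : ∀ j (f g : Word → Bool) →
  levelSum j (λ w → f w xor g w) ≡ levelSum j f xor levelSum j g
levelSum-xor zero f g = refl
levelSum-xor (suc j) f g = trans
  (cong₂ _xor_ (levelSum-xor j (λ w → f (false ∷ w)) (λ w → g (false ∷ w)))
               (levelSum-xor j (λ w → f (true ∷ w)) (λ w → g (true ∷ w))))
  (xor-interchange (levelSum j (λ w → f (false ∷ w))) _ _ _)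

levelSum-false : ∀ j → levelSum j (λ _ → false) ≡ false
levelSum-false zero = refl
levelSum-false (suc j) rewrite levelSum-false j = refl

levelSum-invariant≡false : ∀ σ → σ [] ≡ true → (h : Word → Bool) → (∀ u → h (act σ u) ≡ h u) →
  ∀ i → levelSum (suc i) h ≡ false
levelSum-invariant≡false σ ε∅ h h-inv zero = begin
    h (false ∷ []) xor h (true ∷ [])
  ≡⟨ cong (λ b → h (false ∷ []) xor h (b ∷ [])) (sym ε∅) ⟩
    h (false ∷ []) xor h (σ [] ∷ [])
  ≡⟨ cong (λ w → h (false ∷ []) xor h w) (sym (act-∷ σ false [])) ⟩
    h (false ∷ []) xor h (act σ (false ∷ []))
  ≡⟨ cong (h (false ∷ []) xor_) (h-inv (false ∷ [])) ⟩
    h (false ∷ []) xor h (false ∷ [])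
  ≡⟨ xor-same (h (false ∷ [])) ⟩
    false
  ∎
levelSum-invariant≡false σ ε∅ h h-inv (suc i) =
  trans (sym (levelSum-xor (suc i) (λ w → h (false ∷ w)) (λ w → h (true ∷ w))))
        (levelSum-invariant≡false σ ε∅ headSum headSum-inv i)
  where
  headSum : Word → Bool
  headSum u = h (false ∷ u) xor h (true ∷ u)
  headSum-inv : ∀ u → headSum (act σ u) ≡ headSum u
  headSum-inv u with flipBit σ u | act-∷ σ false u | act-∷ σ true u
  ... | false | σx | σy =
    cong₂ _xor_ (trans (cong h (sym σx)) (h-inv (false ∷ u))) (trans (cong h (sym σy)) (h-inv (true ∷ u)))
  ... | true | σx | σy =
    trans (cong₂ _xor_ (trans (cong h (sym σy)) (h-inv (true ∷ u))) (trans (cong h (sym σx)) (h-inv (false ∷ u))))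
          (xor-comm (h (true ∷ u)) (h (false ∷ u)))

module Involutive (σ : Ω∞) (σ²≡id : ∀ u → act σ (act σ u) ≡ u) where

  flipBit-invariant : ∀ u → flipBit σ (act σ u) ≡ flipBit σ u
  flipBit-invariant u = sym (xor≡false⇒≡ (flipBit σ u) _ (just-injective (cong head (begin
      (flipBit σ u xor flipBit σ (act σ u)) ∷ act σ (act σ u)
    ≡⟨ sym (act-∷ σ (flipBit σ u) (act σ u)) ⟩
      act σ ((false xor flipBit σ u) ∷ act σ u)
    ≡⟨ cong (act σ) (sym (act-∷ σ false u)) ⟩
      act σ (act σ (false ∷ u))
    ≡⟨ σ²≡id (false ∷ u) ⟩
      false ∷ u
    ∎))))

  coordinate≡flipBit-xor : ∀ b u → σ (b ∷ u) ≡ flipBit σ (b ∷ u) xor flipBit σ u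
  coordinate≡flipBit-xor b u = sym (≡xor⇒xor≡ _ _ _ (begin
      flipBit σ (b ∷ u)
    ≡⟨ sym (flipBit-invariant (b ∷ u)) ⟩
      flipBit σ (act σ (b ∷ u))
    ≡⟨ cong (flipBit σ) (act-∷ σ b u) ⟩
      flipBit σ ((b xor flipBit σ u) ∷ act σ u)
    ≡⟨ flipBit-∷ σ _ (act σ u) ⟩
      flipBit σ (act σ u) xor σ (act σ ((b xor flipBit σ u) ∷ act σ u))
    ≡⟨ cong₂ (λ p q → p xor σ q) (flipBit-invariant u) (trans (cong (act σ) (sym (act-∷ σ b u))) (σ²≡id (b ∷ u))) ⟩
      flipBit σ u xor σ (b ∷ u)
    ∎))

  rootSwap⇒φ-suc≡false : σ [] ≡ true → ∀ i → φ (suc i) σ ≡ false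
  rootSwap⇒φ-suc≡false ε∅ i = begin
      φ (suc i) σ
    ≡⟨ φ≡levelSum (suc i) σ ⟩
      levelSum i (λ w → σ (false ∷ w)) xor levelSum i (λ w → σ (true ∷ w))
    ≡⟨ cong₂ _xor_ (trans (levelSum-cong i (coordinate≡flipBit-xor false)) (levelSum-xor i _ F))
                   (trans (levelSum-cong i (coordinate≡flipBit-xor true)) (levelSum-xor i _ F)) ⟩
      (levelSum i (λ w → F (false ∷ w)) xor levelSum i F) xor (levelSum i (λ w → F (true ∷ w)) xor levelSum i F)
    ≡⟨ xor-interchange (levelSum i (λ w → F (false ∷ w))) _ _ _ ⟩
      levelSum (suc i) F xor (levelSum i F xor levelSum i F)
    ≡⟨ cong₂ _xor_ (levelSum-invariant≡false σ ε∅ F flipBit-invariant i) (xor-same (levelSum i F)) ⟩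
      false
    ∎
    where
    F : Word → Bool
    F = flipBit σ

flipBit-invariant⇒involutive : ∀ σ → (∀ u → flipBit σ (act σ u) ≡ flipBit σ u) →
  ∀ u → act σ (act σ u) ≡ u
flipBit-invariant⇒involutive σ F-inv [] = refl
flipBit-invariant⇒involutive σ F-inv (b ∷ u) = begin
    act σ (act σ (b ∷ u))
  ≡⟨ cong (act σ) (act-∷ σ b u) ⟩
    act σ ((b xor flipBit σ u) ∷ act σ u)
  ≡⟨ act-∷ σ _ (act σ u) ⟩
    ((b xor flipBit σ u) xor flipBit σ (act σ u)) ∷ act σ (act σ u)
  ≡⟨ cong₂ _∷_ (trans (cong ((b xor flipBit σ u) xor_) (F-inv u)) (≡xor⇒xor≡ _ _ b (xor-comm b _)))
               (flipBit-invariant⇒involutive σ F-inv u) ⟩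
    b ∷ u
  ∎

flipBit≡true⇒nontrivial : ∀ σ u → flipBit σ u ≡ true → ¬ (∀ v → act σ v ≡ v)
flipBit≡true⇒nontrivial σ u F≡true σ≡id
  with trans (sym F≡true) (just-injective (cong head (trans (sym (act-∷ σ false u)) (σ≡id (false ∷ u)))))
... | ()

involution-criterion : ∀ σ → (∀ u → flipBit σ (act σ u) ≡ flipBit σ u) →
  (∃ λ u → flipBit σ u ≡ true) → IsInvolution σ
involution-criterion σ F-inv (u , F≡true) =
  flipBit-invariant⇒involutive σ F-inv , flipBit≡true⇒nontrivial σ u F≡true

allX : Word → Bool
allX [] = true
allX (false ∷ w) = allX w
allX (true ∷ w) = false

-- the coordinates of  σ_∅^{x₀} ∏_k σ_{yx^k}^{x_{k+1}}
section : (ℕ → Bool) → Ω∞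
section x [] = x 0
section x (false ∷ w) = false
section x (true ∷ w) = allX w ∧ x (suc (length w))

levelSum-allX : ∀ i (g : ℕ → Bool) → levelSum i (λ w → allX w ∧ g (length w)) ≡ g i
levelSum-allX zero g = refl
levelSum-allX (suc i) g =
  trans (cong₂ _xor_ (levelSum-allX i (λ k → g (suc k))) (levelSum-false i)) (xor-identityʳ (g (suc i)))

φ-section : ∀ x i → φ i (section x) ≡ x i
φ-section x zero = xor-identityʳ (x 0)
φ-section x (suc i) = trans (φ≡levelSum (suc i) (section x))
  (cong₂ _xor_ (levelSum-false i) (levelSum-allX i (λ k → x (suc k))))

section-basis₀-involution : ∀ t → t 0 ≡ true → (∀ j → t (suc j) ≡ false) → IsInvolution (section t)
section-basis₀-involution t t₀ t-rest = involution-criterion σ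
  (λ u → trans (flipBit≡true (act σ u)) (sym (flipBit≡true u))) ([] , t₀)
  where
  σ : Ω∞
  σ = section t
  σ-∷≡false : ∀ c w → σ (c ∷ w) ≡ false
  σ-∷≡false false w = refl
  σ-∷≡false true w rewrite t-rest (length w) = ∧-zeroʳ (allX w)
  flipBit≡true : ∀ u → flipBit σ u ≡ true
  flipBit≡true [] = t₀
  flipBit≡true (b ∷ u)
    rewrite flipBit-∷ σ b u | act-∷ σ b u | σ-∷≡false (b xor flipBit σ u) (act σ u) | flipBit≡true u = refl

extendRun : Bool → ℕ → Maybe ℕ → Maybe ℕ
extendRun b n (just k) = just k
extendRun b n nothing = if b then just n else nothing

-- xRun w = just k exactly when w = v' y x^k
xRun : Word → Maybe ℕ
xRun [] = nothing
xRun (b ∷ u) = extendRun b (length u) (xRun u)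

allX≡isNothing-xRun : ∀ w → allX w ≡ is-nothing (xRun w)
allX≡isNothing-xRun [] = refl
allX≡isNothing-xRun (false ∷ w) with xRun w | allX≡isNothing-xRun w
... | just k | e = e
... | nothing | e = e
allX≡isNothing-xRun (true ∷ w) with xRun w
... | just k = refl
... | nothing = refl

xRun-replicate : ∀ m → xRun (replicate m false) ≡ nothing
xRun-replicate zero = refl
xRun-replicate (suc m) rewrite xRun-replicate m = refl

runValue : (ℕ → Bool) → Maybe ℕ → Bool
runValue t nothing = false
runValue t (just k) = t (suc k)

extendRun-flip : ∀ t b n X → extendRun (b xor runValue t X) n X ≡ extendRun b n X
extendRun-flip t b n (just k) = refl
extendRun-flip t b n nothing = cong (λ c → extendRun c n nothing) (xor-identityʳ b)

module ZerothFreeSection (t : ℕ → Bool) (t₀ : t 0 ≡ false) where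

  σ : Ω∞
  σ = section t

  value : Word → Bool
  value w = runValue t (xRun w)

  section-∷ : ∀ c w → σ (c ∷ w) ≡ value w xor value (c ∷ w)
  section-∷ c w with xRun w | allX≡isNothing-xRun w
  section-∷ false w | just k | _ = sym (xor-same (t (suc k)))
  section-∷ true w | just k | allX≡false rewrite allX≡false = sym (xor-same (t (suc k)))
  section-∷ false w | nothing | _ = refl
  section-∷ true w | nothing | allX≡true rewrite allX≡true = refl

  invariants : ∀ u → (flipBit σ u ≡ value u) × (xRun (act σ u) ≡ xRun u)
  invariants [] = t₀ , refl
  invariants (b ∷ u) = flipBit≡ , xRun≡
    where
    F≡u : flipBit σ u ≡ value u
    F≡u = proj₁ (invariants u)
    xRun≡u : xRun (act σ u) ≡ xRun u
    xRun≡u = proj₂ (invariants u)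
    c : Bool
    c = b xor flipBit σ u
    xRun≡ : xRun (act σ (b ∷ u)) ≡ xRun (b ∷ u)
    xRun≡ = begin
        xRun (act σ (b ∷ u))
      ≡⟨ cong xRun (act-∷ σ b u) ⟩
        extendRun c (length (act σ u)) (xRun (act σ u))
      ≡⟨ cong₂ (extendRun c) (length-act σ u) xRun≡u ⟩
        extendRun c (length u) (xRun u)
      ≡⟨ cong (λ z → extendRun (b xor z) (length u) (xRun u)) F≡u ⟩
        extendRun (b xor value u) (length u) (xRun u)
      ≡⟨ extendRun-flip t b (length u) (xRun u) ⟩
        xRun (b ∷ u)
      ∎
    flipBit≡ : flipBit σ (b ∷ u) ≡ value (b ∷ u)
    flipBit≡ = begin
        flipBit σ (b ∷ u)
      ≡⟨ flipBit-∷ σ b u ⟩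
        flipBit σ u xor σ (act σ (b ∷ u))
      ≡⟨ cong₂ _xor_ F≡u (cong σ (act-∷ σ b u)) ⟩
        value u xor σ (c ∷ act σ u)
      ≡⟨ cong (value u xor_) (section-∷ c (act σ u)) ⟩
        value u xor (value (act σ u) xor value (c ∷ act σ u))
      ≡⟨ cong (λ X → value u xor (runValue t X xor value (c ∷ act σ u))) xRun≡u ⟩
        value u xor (value u xor value (c ∷ act σ u))
      ≡⟨ xor-cancelˡ (value u) _ ⟩
        value (c ∷ act σ u)
      ≡⟨ cong (runValue t) (trans (cong xRun (sym (act-∷ σ b u))) xRun≡) ⟩
        value (b ∷ u)
      ∎

  involution : ∀ m → t (suc m) ≡ true → IsInvolution σ
  involution m t₁₊ₘ = involution-criterion σ flipBit-invariant (true ∷ replicate m false , flipBit≡true)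
    where
    flipBit-invariant : ∀ u → flipBit σ (act σ u) ≡ flipBit σ u
    flipBit-invariant u = trans (proj₁ (invariants (act σ u)))
      (trans (cong (runValue t) (proj₂ (invariants u))) (sym (proj₁ (invariants u))))
    flipBit≡true : flipBit σ (true ∷ replicate m false) ≡ true
    flipBit≡true rewrite proj₁ (invariants (true ∷ replicate m false))
                       | xRun-replicate m | length-replicate m {false} = t₁₊ₘ

basis : ℕ → ℕ → Bool
basis i j = j ≡ᵇ i

eraseZeroth : (ℕ → Bool) → ℕ → Bool
eraseZeroth x zero = false
eraseZeroth x (suc j) = x (suc j)

dot-cong : ∀ a {x y : ℕ → Bool} → (∀ i → x i ≡ y i) → dot a x ≡ dot a y
dot-cong [] x≗y = refl
dot-cong (b ∷ a) x≗y = cong₂ (λ p q → (b ∧ p) xor q) (x≗y 0) (dot-cong a (λ i → x≗y (suc i)))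

dot-zero : ∀ a → dot a (λ _ → false) ≡ false
dot-zero [] = refl
dot-zero (b ∷ a) rewrite ∧-zeroʳ b | dot-zero a = refl

dot-xor : ∀ a x y → dot a (λ j → x j xor y j) ≡ dot a x xor dot a y
dot-xor [] x y = refl
dot-xor (false ∷ a) x y = dot-xor a _ _
dot-xor (true ∷ a) x y =
  trans (cong ((x 0 xor y 0) xor_) (dot-xor a _ _)) (xor-interchange (x 0) (y 0) _ _)

dot-basis : ∀ a i → dot a (basis i) ≡ coef a i
dot-basis [] i = refl
dot-basis (b ∷ a) zero rewrite ∧-identityʳ b | dot-zero a = xor-identityʳ b
dot-basis (b ∷ a) (suc i) rewrite ∧-zeroʳ b = dot-basis a i

basis-xor-InX : ∀ a i j → coef a i ≡ coef a j → InX a (λ k → basis i k xor basis j k)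
basis-xor-InX a i j aᵢ≡aⱼ = begin
    dot a (λ k → basis i k xor basis j k)
  ≡⟨ dot-xor a (basis i) (basis j) ⟩
    dot a (basis i) xor dot a (basis j)
  ≡⟨ cong₂ _xor_ (dot-basis a i) (trans (dot-basis a j) (sym aᵢ≡aⱼ)) ⟩
    coef a i xor coef a i
  ≡⟨ xor-same (coef a i) ⟩
    false
  ∎

coef≢true⇒dot≡false : ∀ a → (∀ i → ¬ coef a i ≡ true) → ∀ x → dot a x ≡ false
coef≢true⇒dot≡false [] _ x = refl
coef≢true⇒dot≡false (false ∷ a) aᵢ≢true x = coef≢true⇒dot≡false a (λ i → aᵢ≢true (suc i)) _
coef≢true⇒dot≡false (true ∷ a) aᵢ≢true x with aᵢ≢true 0 refl
... | ()

dot-tail≡false : ∀ b a → ¬ (Σ ℕ λ i → (0 < i) × (coef (b ∷ a) i ≡ true)) →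
  ∀ (x : ℕ → Bool) → dot a (λ i → x (suc i)) ≡ false
dot-tail≡false b a no-later x =
  coef≢true⇒dot≡false a (λ i aᵢ → no-later (suc i , s≤s z≤n , aᵢ)) (λ i → x (suc i))

eraseZeroth-InX : ∀ a x → Cond1 a → InX a x → InX a (eraseZeroth x)
eraseZeroth-InX [] x _ _ = refl
eraseZeroth-InX (b ∷ a) x (inj₁ refl) x∈X = x∈X
eraseZeroth-InX (b ∷ a) x (inj₂ no-later) _ rewrite ∧-zeroʳ b = dot-tail≡false b a no-later x

zeroth≡true⇒coef₀≡false : ∀ a x → Cond1 a → InX a x → x 0 ≡ true → coef a 0 ≡ false
zeroth≡true⇒coef₀≡false [] x _ _ _ = refl
zeroth≡true⇒coef₀≡false (b ∷ a) x (inj₁ b≡false) _ _ = b≡false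
zeroth≡true⇒coef₀≡false (b ∷ a) x (inj₂ no-later) x∈X x₀ = begin
    b
  ≡⟨ sym (∧-identityʳ b) ⟩
    b ∧ true
  ≡⟨ sym (xor-identityʳ (b ∧ true)) ⟩
    (b ∧ true) xor false
  ≡⟨ cong₂ (λ p q → (b ∧ p) xor q) (sym x₀) (sym (dot-tail≡false b a no-later x)) ⟩
    dot (b ∷ a) x
  ≡⟨ x∈X ⟩
    false
  ∎

basis₀-InX : ∀ a → coef a 0 ≡ false → InX a (basis 0)
basis₀-InX [] _ = refl
basis₀-InX (b ∷ a) refl = dot-zero a

sumSeq-++ : ∀ ts us i → sumSeq (ts ++ us) i ≡ sumSeq ts i xor sumSeq us i
sumSeq-++ [] us i = refl
sumSeq-++ (t ∷ ts) us i = trans (cong (t i xor_) (sumSeq-++ ts us i)) (sym (xor-assoc (t i) _ _))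

sumSeq≡true⇒member : ∀ {T : (ℕ → Bool) → Set} ts → All T ts → ∀ i → sumSeq ts i ≡ true →
  ∃ λ t → T t × t i ≡ true
sumSeq≡true⇒member [] [] i ()
sumSeq≡true⇒member (t ∷ ts) (t∈T ∷ ts⊆T) i sum≡true with t i in tᵢ
... | true = t , t∈T , tᵢ
... | false = sumSeq≡true⇒member ts ts⊆T i sum≡true

Generator : List Bool → (ℕ → Bool) → Set
Generator a t = InX a t × (∃ λ i → t i ≡ true) × (t 0 ≡ false ⊎ (∀ j → t (suc j) ≡ false))

section-involution : ∀ a t → Generator a t → IsInvolution (section t)
section-involution a t (_ , (zero , t₀) , inj₂ t-rest) = section-basis₀-involution t t₀ t-rest
section-involution a t (_ , (suc m , tₘ) , inj₁ t₀) = ZerothFreeSection.involution t t₀ m tₘ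
section-involution a t (_ , (zero , t₀) , inj₁ t₀≡false) with trans (sym t₀) t₀≡false
... | ()
section-involution a t (_ , (suc j , tⱼ) , inj₂ t-rest) with trans (sym tⱼ) (t-rest j)
... | ()

Approximation : ((ℕ → Bool) → Set) → (ℕ → Bool) → ℕ → Set
Approximation T x n = Σ (List (ℕ → Bool)) λ ts → All T ts × (∀ i → i < n → sumSeq ts i ≡ x i)

approximation-support : ∀ {T x n} → Approximation T x n → ∀ {i} → i < n → x i ≡ true →
  ∃ λ t → T t × t i ≡ true
approximation-support (ts , ts⊆T , ts≈) {i} i<n xᵢ = sumSeq≡true⇒member ts ts⊆T i (trans (ts≈ i i<n) xᵢ)

approximation-xor : ∀ {T x y n} → Approximation T x n → Approximation T y n →
  Approximation T (λ i → x i xor y i) n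
approximation-xor (ts , ts⊆T , ts≈) (us , us⊆T , us≈) =
  ts ++ us , ++⁺ ts⊆T us⊆T , λ i i<n → trans (sumSeq-++ ts us i) (cong₂ _xor_ (ts≈ i i<n) (us≈ i i<n))

approximation-cong : ∀ {T x y n} → (∀ i → x i ≡ y i) → Approximation T x n → Approximation T y n
approximation-cong x≗y (ts , ts⊆T , ts≈) = ts , ts⊆T , λ i i<n → trans (ts≈ i i<n) (x≗y i)

zerothPart-generated : ∀ a → Cond1 a → ∀ x → InX a x →
  ∀ n → Approximation (Generator a) (λ i → basis 0 i ∧ x 0) n
zerothPart-generated a c x x∈X n with x 0 in x₀
... | false = [] , [] , λ i _ → sym (∧-zeroʳ (basis 0 i))
... | true = basis 0 ∷ [] , e₀∈G ∷ [] , λ i _ → trans (xor-identityʳ _) (sym (∧-identityʳ _))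
  where
  e₀∈G : Generator a (basis 0)
  e₀∈G = basis₀-InX a (zeroth≡true⇒coef₀≡false a x c x∈X x₀) , (0 , refl) , inj₂ (λ _ → refl)

restPart-generated : ∀ a → Cond1 a → ∀ x → InX a x → ∀ n → Approximation (Generator a) (eraseZeroth x) n
restPart-generated a c x x∈X n with anyUpTo? (λ i → eraseZeroth x i ≟ᵇ true) n
... | yes (i , _ , xᵢ) =
  eraseZeroth x ∷ [] , (eraseZeroth-InX a x c x∈X , (i , xᵢ) , inj₁ refl) ∷ [] , λ j _ → xor-identityʳ _
... | no no-one-below-n = [] , [] , λ i i<n → sym (¬-not (λ xᵢ → no-one-below-n (i , i<n , xᵢ)))

zerothPart-xor-restPart : ∀ x i → (basis 0 i ∧ x 0) xor eraseZeroth x i ≡ x i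
zerothPart-xor-restPart x zero = xor-identityʳ (x 0)
zerothPart-xor-restPart x (suc i) = refl

generators-generate : ∀ a → Cond1 a → ∀ x → InX a x → ∀ n → Approximation (Generator a) x n
generators-generate a c x x∈X n = approximation-cong (zerothPart-xor-restPart x)
  (approximation-xor (zerothPart-generated a c x x∈X n) (restPart-generated a c x x∈X n))

cond1⇒cond2 : ∀ a → Cond1 a → Cond2 a
cond1⇒cond2 a c =
    (λ x x∈X → section x , trans (dot-cong a (φ-section x)) x∈X)
  , (λ x _ → φ-section x)
  , Generator a
  , ((λ _ → proj₁) , generators-generate a c)
  , λ t _ → section-involution a t

involutive-lift⇒tail≡false : ∀ σ → (∀ u → act σ (act σ u) ≡ u) → (t : ℕ → Bool) → (∀ i → φ i σ ≡ t i) →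
  t 0 ≡ true → ∀ j → t (suc j) ≡ false
involutive-lift⇒tail≡false σ σ²≡id t φσ≡t t₀ j = trans (sym (φσ≡t (suc j)))
  (Involutive.rootSwap⇒φ-suc≡false σ σ²≡id (trans (sym (xor-identityʳ (σ []))) (trans (φσ≡t 0) t₀)) j)

basis₀∉X : ∀ a (t : ℕ → Bool) → t 0 ≡ true → (∀ j → t (suc j) ≡ false) → ¬ InX (true ∷ a) t
basis₀∉X a t t₀ t-rest t∈X
  with trans (sym t∈X) (cong₂ (λ p q → (true ∧ p) xor q) t₀ (trans (dot-cong a t-rest) (dot-zero a)))
... | ()

cond2⇒cond1 : ∀ a → Cond2 a → Cond1 a
cond2⇒cond1 [] _ = inj₁ refl
cond2⇒cond1 (false ∷ a) _ = inj₁ refl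
cond2⇒cond1 (true ∷ a) (f , f-section , T , (T⊆X , T-generates) , T-involution) = inj₂ no-later-coef
  where
  no-later-coef : ¬ (Σ ℕ λ i → (0 < i) × (coef (true ∷ a) i ≡ true))
  no-later-coef (suc i , _ , aᵢ)
    with approximation-support
           (T-generates (λ k → basis 0 k xor basis (suc i) k) (basis-xor-InX (true ∷ a) 0 (suc i) (sym aᵢ)) 1)
           (s≤s z≤n) refl
  ... | t , t∈T , t₀ = basis₀∉X a t t₀ t-rest t∈X
    where
    t∈X : InX (true ∷ a) t
    t∈X = T⊆X t t∈T
    t-rest : ∀ j → t (suc j) ≡ false
    t-rest =
      involutive-lift⇒tail≡false (proj₁ (f t t∈X)) (proj₁ (T-involution t t∈X t∈T)) t (f-section t t∈X) t₀

proposition7p2 : (a : List Bool) → Cond1 a ⇔ Cond2 a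
proposition7p2 a = mk⇔ (cond1⇒cond2 a) (cond2⇒cond1 a)
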